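{- Let $m\geq 2$ be square-free and let $d\geq k\geq 2$ be integers. Let $f(x)=\sum_{i=k}^d a_ix^i\in\mathbb{Z}[x]$ with $a_d\neq 0$ and $\gcd(a_k,m)=1$, and suppose that zero is the only root of $f$ modulo $m$ (i.e. $f(x)\equiv 0\pmod m$ implies $x\equiv 0\pmod m$). Let $R\subseteq\{0,1,\dots,m-1\}$ be a set such that for all distinct $r,r'\in R$, $r-r'$ is not congruent modulo $m$ to any $k$th power $x^k$, $x\in\mathbb{Z}$. Let \[\gamma=\frac{d-1+\log_m|R|}{d}.\] Then there is a constant $c>0$ depending only on $m$ and $f$ such that for every positive integer $N$ there exists a set $A\subseteq[N]$ with $(A-A)\cap f(\mathbb{Z})=\{0\}$ and $|A|\geq cN^{\gamma}$.
   Context: $[N]=\{1,2,\dots,N\}$; $A-A=\{a-a':a,a'\in A\}$; $f(\mathbb{Z})=\{f(x):x\in\mathbb{Z}\}$. -}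

module Defs where

open import Data.Nat as ℕ using (ℕ; zero; suc; _≤_; _<_)
open import Data.Nat.Primality using (Prime)
open import Data.Nat.Divisibility as ℕD using ()
open import Data.Integer as ℤ using (ℤ; +_)
open import Data.Integer.Divisibility using (_∣_)
open import Data.Fin using (Fin; toℕ)
open import Relation.Nullary using (¬_)

SquareFree : ℕ → Set
SquareFree m = ∀ p → Prime p → ¬ (ℕD._∣_ (p ℕ.* p) m)

infix 4 _≡_[mod_]
_≡_[mod_] : ℤ → ℤ → ℕ → Set
a ≡ b [mod m ] = (+ m) ∣ (a ℤ.- b)

evalUpTo : (ℕ → ℤ) → ℕ → ℤ → ℤ
evalUpTo a zero    x = a 0
evalUpTo a (suc n) x = evalUpTo a n x ℤ.+ a (suc n) ℤ.* (x ℤ.^ suc n)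

-- the element of [N] = {1,…,N} encoded by an index i : Fin N
elem : ∀ {N} → Fin N → ℤ
elem i = + suc (toℕ i)

{-# OPTIONS --safe #-}

-- Take A = {c·ν} with c = |a_k|, where ν read in base m has digit 0 in position 0, a digit from R in
-- each position kj (1 ≤ j ≤ L), free digits in the other positions up to kL, and a top part below
-- m^{(d−k)J}. Suppose f(x) = c(ν − ν′) ≠ 0 and let p be the lowest position where the digits of ν, ν′
-- differ, so that f(x) = m^p·u with m ∤ u. Since f(x) = x^k (a_k + x g(x)), 0 is the only root of f
-- mod m and m is square-free, writing x = m^s y with m ∤ y gives p = sk and u ≡ a_k y^k (mod m).
-- So p is neither 0 nor a free position, and if p = kj the two digits r, r′ from R satisfy
-- c(r − r′) ≡ ±c y^k, making r − r′ or r′ − r a k-th power mod m. If instead the digits agree up to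
-- position kL, then m^{L+1} ∣ x, and the lower bound |f(x)| ≥ |x|^{d−1} m^L ≥ m^{(L+1)(d−1)+L} beats
-- the upper bound |f(x)| = m^{kL+1} c|ν − ν′| < c m^{kL+1+(d−k)J} once L ≥ J + const.
-- Counting digit patterns gives |A| = (m^{k−1}|R|)^L m^{(d−k)J} inside [N] with N ≈ m^{dJ}, and
-- L = J + O(1) yields |A| ≫ N^γ.

module Submission where

open import Defs
open import Data.Nat as ℕ using (ℕ; zero; suc; _≤_; _<_; z≤n; s≤s)
import Data.Nat.Properties as ℕP
open import Data.Nat.Divisibility as ℕD using (divides)
open import Data.Nat.DivMod
  using (_%_; _/_; m≡m%n+[m/n]*n; m%n<n; m<n⇒m%n≡m; m<n⇒m/n≡0; [m+n]%n≡m%n; [m+kn]%n≡m%n; m*n%n≡0; m/n≡1+[m∸n]/n)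
open import Data.Nat.GCD using (gcd; gcd[m,n]∣m; gcd[m,n]∣n; gcd-greatest)
open import Data.Nat.Primality using (Prime; euclidsLemma; ¬prime[1])
open import Data.Nat.Primality.Factorisation using (PrimeFactorisation; factorise)
open import Data.Nat.Coprimality as Coprimality using (Coprime; coprime-divisor)
import Data.Nat.Solver
open import Data.Integer as ℤ using (ℤ; +_; ∣_∣)
import Data.Integer.Properties as ℤP
open import Data.Integer.Divisibility.Signed as Signed using (divides) renaming (_∣_ to _∣ₛ_)
import Data.Integer.Solver
open import Data.Bool using (Bool; true; false; _∧_; T)
open import Data.Bool.Properties using (T-≡; T-∧)
open import Data.Fin as Fin using (Fin; toℕ; fromℕ<)
import Data.Fin.Properties as FinP
open import Data.Fin.Subset using (Subset; _∈_; ⁅_⁆) renaming (∣_∣ to ∣_∣ₛ)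
open import Data.Fin.Subset.Properties using (∣⁅x⁆∣≡1; x∈⁅y⁆⇒x≡y; ∣p∣≤n)
open import Data.Vec using ([]; _∷_; lookup; tabulate)
import Data.Vec.Properties as VecP
open import Data.List using (List; []; _∷_; _++_; length; replicate)
import Data.List.Properties as ListP
open import Data.List.Relation.Unary.All using (_∷_)
open import Data.Product using (Σ; ∃-syntax; _×_; _,_; proj₁; proj₂)
open import Data.Sum using (inj₁; inj₂)
open import Data.Unit using (⊤; tt)
open import Data.Empty using (⊥; ⊥-elim)
open import Function using (Equivalence; _∘_)
open import Relation.Nullary using (¬_; yes; no)
open import Relation.Binary.PropositionalEquality

-- Integers and polynomials

module _ where
  open import Data.Integer using (_+_; _*_; _^_)
  open Data.Integer.Solver.+-*-Solver

  ∣i^n∣≡∣i∣^n : ∀ i n → ∣ i ^ n ∣ ≡ ∣ i ∣ ℕ.^ n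
  ∣i^n∣≡∣i∣^n i zero    = refl
  ∣i^n∣≡∣i∣^n i (suc n) = trans (ℤP.abs-* i (i ^ n)) (cong (∣ i ∣ ℕ.*_) (∣i^n∣≡∣i∣^n i n))

  [i*j]^n≡i^n*j^n : ∀ i j n → (i * j) ^ n ≡ i ^ n * j ^ n
  [i*j]^n≡i^n*j^n i j zero    = refl
  [i*j]^n≡i^n*j^n i j (suc n) rewrite [i*j]^n≡i^n*j^n i j n =
    solve 4 (λ I J P Q → I :* J :* (P :* Q) := I :* P :* (J :* Q)) refl i j (i ^ n) (j ^ n)

  evalUpTo-below : ∀ (a : ℕ → ℤ) {k} → (∀ i → i < k → a i ≡ + 0) → ∀ n x → n < k → evalUpTo a n x ≡ + 0
  evalUpTo-below a low zero    x n<k = low 0 n<k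
  evalUpTo-below a low (suc n) x n<k
    rewrite evalUpTo-below a low n x (ℕP.<-trans (ℕP.n<1+n n) n<k) | low (suc n) n<k = refl

  evalUpTo-factor : ∀ (a : ℕ → ℤ) k′ → (∀ i → i < suc k′ → a i ≡ + 0) →
                    ∀ j x → ∃[ G ] evalUpTo a (suc k′ ℕ.+ j) x ≡ x ^ suc k′ * (a (suc k′) + x * G)
  evalUpTo-factor a k′ low zero x rewrite ℕP.+-identityʳ k′ | evalUpTo-below a low k′ x ℕP.≤-refl =
    + 0 , solve 3 (λ A X Y → con (+ 0) :+ A :* (X :* Y) := X :* Y :* (A :+ X :* con (+ 0)))
                  refl (a (suc k′)) x (x ^ k′)
  evalUpTo-factor a k′ low (suc j) x with evalUpTo-factor a k′ low j x
  ... | G , eq = G + b * x ^ j , (begin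
    evalUpTo a (k ℕ.+ suc j) x
      ≡⟨ cong (λ t → evalUpTo a t x) (ℕP.+-suc k j) ⟩
    evalUpTo a (k ℕ.+ j) x + b * (x * x ^ (k ℕ.+ j))
      ≡⟨ cong₂ (λ u v → u + b * (x * v)) eq (ℤP.^-distribˡ-+-* x k j) ⟩
    x ^ k * (a k + x * G) + b * (x * (x ^ k * x ^ j))
      ≡⟨ solve 6 (λ P A X G B Q → P :* (A :+ X :* G) :+ B :* (X :* (P :* Q)) := P :* (A :+ X :* (G :+ B :* Q)))
                 refl (x ^ k) (a k) x G b (x ^ j) ⟩
    x ^ k * (a k + x * (G + b * x ^ j)) ∎)
    where
    open ≡-Reasoning
    k = suc k′
    b = a (suc (k ℕ.+ j))

-- Square-free moduli

prime∣^⇒prime∣ : ∀ {p} n k → Prime p → p ℕD.∣ n ℕ.^ k → p ℕD.∣ n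
prime∣^⇒prime∣ n zero    p-prime p∣1 = ⊥-elim (¬prime[1] (subst Prime (ℕD.∣1⇒≡1 p∣1) p-prime))
prime∣^⇒prime∣ n (suc k) p-prime p∣n^k+1 with euclidsLemma n (n ℕ.^ k) p-prime p∣n^k+1
... | inj₁ p∣n   = p∣n
... | inj₂ p∣n^k = prime∣^⇒prime∣ n k p-prime p∣n^k

-- Write m = h · gcd m n: a prime factor of h divides n, hence gcd m n, so its square divides m.
squareFree-∣^⇒∣ : ∀ {m} → SquareFree m → m ≢ 0 → ∀ n k → m ℕD.∣ n ℕ.^ k → m ℕD.∣ n
squareFree-∣^⇒∣ {m} sf m≢0 n k m∣n^k with gcd[m,n]∣m m n
... | divides h m≡h*g with h ℕ.≟ 1
...   | yes refl = subst (ℕD._∣ n) (trans (sym (ℕP.*-identityˡ _)) (sym m≡h*g)) (gcd[m,n]∣n m n)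
...   | no h≢1   = ⊥-elim (primeFactorOf-h (factorise h {{h≢0}}))
  where
  h≢0 : ℕ.NonZero h
  h≢0 = ℕ.≢-nonZero λ h≡0 → m≢0 (trans m≡h*g (cong (ℕ._* gcd m n) h≡0))
  primeFactorOf-h : PrimeFactorisation h → ⊥
  primeFactorOf-h record { factors = [] ; isFactorisation = h≡1 } = h≢1 h≡1
  primeFactorOf-h record { factors = p ∷ _ ; isFactorisation = h≡∏factors ; factorsPrime = p-prime ∷ _ } =
    sf p p-prime (subst (p ℕ.* p ℕD.∣_) (sym m≡h*g) (ℕD.*-pres-∣ p∣h p∣g))
    where
    p∣h : p ℕD.∣ h
    p∣h = subst (p ℕD.∣_) (sym h≡∏factors) (ℕD.m∣m*n _)
    p∣m : p ℕD.∣ m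
    p∣m = subst (p ℕD.∣_) (sym m≡h*g) (ℕD.∣m⇒∣m*n _ p∣h)
    p∣g : p ℕD.∣ gcd m n
    p∣g = gcd-greatest p∣m (prime∣^⇒prime∣ n k p-prime (ℕD.∣-trans p∣m m∣n^k))

∣m-n∣<B : ∀ {a b B} → a < B → b < B → ∣ + a ℤ.- + b ∣ < B
∣m-n∣<B {a} {b} a<B b<B =
  ℕP.≤-<-trans (subst (ℕ._≤ a ℕ.⊔ b) (cong ∣_∣ (sym (ℤP.m-n≡m⊖n a b))) (ℤP.∣m⊝n∣≤m⊔n a b)) (ℕP.⊔-pres-<m a<B b<B)

∣∧<⇒≡0 : ∀ {m n} → m ℕD.∣ n → n < m → n ≡ 0
∣∧<⇒≡0 {n = zero}  _   _   = refl
∣∧<⇒≡0 {n = suc n} m∣n n<m = ⊥-elim (ℕD.>⇒∤ n<m m∣n)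

module MAdic (m : ℕ) (m≥2 : 2 ≤ m) (sf : SquareFree m) where
  open import Data.Integer using (_+_; _*_; _-_; _^_)
  open Data.Integer.Solver.+-*-Solver

  M : ℤ
  M = + m

  m≢0 : m ≢ 0
  m≢0 m≡0 with () ← subst (2 ≤_) m≡0 m≥2

  M^n≢0 : ∀ n → M ^ n ≢ + 0
  M^n≢0 n M^n≡0 = m≢0 (ℤP.+-injective (ℤP.i^n≡0⇒i≡0 M n M^n≡0))

  M^n*-cancelˡ : ∀ n {u w} → M ^ n * u ≡ M ^ n * w → u ≡ w
  M^n*-cancelˡ n {u} {w} = ℤP.*-cancelˡ-≡ (M ^ n) u w {{ℤ.≢-nonZero (M^n≢0 n)}}

  coprime∧M∣*⇒M∣ : ∀ c z → Coprime ∣ c ∣ m → M ∣ₛ c * z → M ∣ₛ z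
  coprime∧M∣*⇒M∣ c z cop M∣cz = Signed.∣ᵤ⇒∣
    (coprime-divisor (Coprimality.sym cop) (subst (m ℕD.∣_) (ℤP.abs-* c z) (Signed.∣⇒∣ᵤ M∣cz)))

  M∣^⇒M∣ : ∀ y n → M ∣ₛ y ^ n → M ∣ₛ y
  M∣^⇒M∣ y n M∣y^n = Signed.∣ᵤ⇒∣
    (squareFree-∣^⇒∣ sf m≢0 ∣ y ∣ n (subst (m ℕD.∣_) (∣i^n∣≡∣i∣^n y n) (Signed.∣⇒∣ᵤ M∣y^n)))

  split-M-power : ∀ x → x ≢ + 0 → ∃[ s ] ∃[ y ] x ≡ M ^ s * y × ¬ (M ∣ₛ y)
  split-M-power x = go ∣ x ∣ x ℕP.≤-refl
    where
    go : ∀ fuel x → ∣ x ∣ ≤ fuel → x ≢ + 0 → ∃[ s ] ∃[ y ] x ≡ M ^ s * y × ¬ (M ∣ₛ y)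
    go fuel x _ x≢0 with m ℕD.∣? ∣ x ∣
    go fuel x _ x≢0 | no M∤x = 0 , x , sym (ℤP.*-identityˡ x) , λ M∣x → M∤x (Signed.∣⇒∣ᵤ M∣x)
    go zero x ∣x∣≤0 x≢0 | yes _ = ⊥-elim (x≢0 (ℤP.∣i∣≡0⇒i≡0 (ℕP.n≤0⇒n≡0 ∣x∣≤0)))
    go (suc fuel) x ∣x∣≤fuel x≢0 | yes M∣x with Signed.∣ᵤ⇒∣ {M} {x} M∣x
    ... | divides q x≡q*M with go fuel q ∣q∣≤fuel q≢0
      where
      q≢0 : q ≢ + 0
      q≢0 q≡0 = x≢0 (trans x≡q*M (cong (_* M) q≡0))
      ∣q∣≤fuel : ∣ q ∣ ≤ fuel
      ∣q∣≤fuel = ℕP.≤-pred (ℕP.<-≤-trans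
        (ℕP.m<m*n ∣ q ∣ m {{ℕ.≢-nonZero (λ ∣q∣≡0 → q≢0 (ℤP.∣i∣≡0⇒i≡0 ∣q∣≡0))}} m≥2)
        (subst (_≤ suc fuel) (trans (cong ∣_∣ x≡q*M) (ℤP.abs-* q M)) ∣x∣≤fuel))
    ... | s , y , q≡M^s*y , M∤y = suc s , y , x≡M^s+1*y , M∤y
      where
      x≡M^s+1*y : x ≡ M ^ suc s * y
      x≡M^s+1*y = trans x≡q*M (trans (cong (_* M) q≡M^s*y)
        (solve 3 (λ P Y Z → P :* Y :* Z := Z :* P :* Y) refl (M ^ s) y M))

  M∣[e-e′]⇒e≡e′ : ∀ {e e′} → e < m → e′ < m → M ∣ₛ + e - + e′ → e ≡ e′
  M∣[e-e′]⇒e≡e′ {e} {e′} e<m e′<m M∣e-e′ = ℤP.+-injective (ℤP.i-j≡0⇒i≡j _ _ (ℤP.∣i∣≡0⇒i≡0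
    (∣∧<⇒≡0 (Signed.∣⇒∣ᵤ M∣e-e′) (∣m-n∣<B e<m e′<m))))

  M^-exponent-≤ : ∀ a b v w → M ^ a * v ≡ M ^ b * w → ¬ (M ∣ₛ w) → a ≤ b
  M^-exponent-≤ a b v w eq M∤w with a ℕP.≤? b
  ... | yes a≤b = a≤b
  ... | no a≰b  = ⊥-elim (M∤w (divides (M ^ t * v) (sym (M^n*-cancelˡ b lhs≡))))
    where
    t = a ℕ.∸ suc b
    a≡b+t+1 : a ≡ b ℕ.+ suc t
    a≡b+t+1 = sym (trans (ℕP.+-suc b t) (ℕP.m+[n∸m]≡n (ℕP.≰⇒> a≰b)))
    lhs≡ : M ^ b * (M ^ t * v * M) ≡ M ^ b * w
    lhs≡ = begin
      M ^ b * (M ^ t * v * M)   ≡⟨ solve 4 (λ B T V X → B :* (T :* V :* X) := B :* (X :* T) :* V) refl (M ^ b) (M ^ t) v M ⟩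
      M ^ b * M ^ suc t * v     ≡⟨ cong (_* v) (sym (ℤP.^-distribˡ-+-* M b (suc t))) ⟩
      M ^ (b ℕ.+ suc t) * v     ≡⟨ cong (λ e → M ^ e * v) (sym a≡b+t+1) ⟩
      M ^ a * v                 ≡⟨ eq ⟩
      M ^ b * w                 ∎
      where open ≡-Reasoning

  -- For composite m there is no m-adic valuation; factorisations x = M^s y with M ∤ y stand in for it,
  -- and square-freeness (M ∣ y^k ⇒ M ∣ y) keeps the cofactor of f(x) prime to M.
  module Valuation (k : ℕ) (k≥1 : 1 ≤ k) (A : ℤ) (cop : Coprime ∣ A ∣ m) (f : ℤ → ℤ)
                   (factor : ∀ x → ∃[ G ] f x ≡ x ^ k * (A + x * G))
                   (onlyRoot : ∀ x → M ∣ₛ f x → M ∣ₛ x) where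

    M∤A*y^k : ∀ y → ¬ (M ∣ₛ y) → ¬ (M ∣ₛ A * y ^ k)
    M∤A*y^k y M∤y M∣Ay^k = M∤y (M∣^⇒M∣ y k (coprime∧M∣*⇒M∣ A (y ^ k) cop M∣Ay^k))

    f-M-adic : ∀ x → x ≢ + 0 → ∃[ s ] ∃[ y ] ∃[ w ]
               x ≡ M ^ s * y × ¬ (M ∣ₛ y) × f x ≡ M ^ (s ℕ.* k) * w × ¬ (M ∣ₛ w) ×
               (1 ≤ s → M ∣ₛ w - A * y ^ k)
    f-M-adic x x≢0 with split-M-power x x≢0
    ... | zero , y , x≡y , M∤y = 0 , y , f x , x≡y , M∤y , sym (ℤP.*-identityˡ (f x)) , M∤fx , λ ()
      where
      M∤fx : ¬ (M ∣ₛ f x)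
      M∤fx M∣fx = M∤y (subst (M ∣ₛ_) (trans x≡y (ℤP.*-identityˡ y)) (onlyRoot x M∣fx))
    ... | suc s , y , x≡M^s+1*y , M∤y = suc s , y , w , x≡M^s+1*y , M∤y , fx≡ , M∤w , λ _ → M∣w-Ay^k
      where
      G = proj₁ (factor x)
      w = y ^ k * (A + x * G)
      fx≡ : f x ≡ M ^ (suc s ℕ.* k) * w
      fx≡ = begin
        f x                                   ≡⟨ proj₂ (factor x) ⟩
        x ^ k * (A + x * G)                   ≡⟨ cong (λ t → t ^ k * (A + x * G)) x≡M^s+1*y ⟩
        (M ^ suc s * y) ^ k * (A + x * G)     ≡⟨ cong (_* (A + x * G)) ([i*j]^n≡i^n*j^n (M ^ suc s) y k) ⟩
        (M ^ suc s) ^ k * y ^ k * (A + x * G) ≡⟨ cong (λ t → t * y ^ k * (A + x * G)) (ℤP.^-*-assoc M (suc s) k) ⟩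
        M ^ (suc s ℕ.* k) * y ^ k * (A + x * G) ≡⟨ ℤP.*-assoc (M ^ (suc s ℕ.* k)) (y ^ k) (A + x * G) ⟩
        M ^ (suc s ℕ.* k) * w                 ∎
        where open ≡-Reasoning
      M∣w-Ay^k : M ∣ₛ w - A * y ^ k
      M∣w-Ay^k = divides (M ^ s * y * y ^ k * G) (begin
        y ^ k * (A + x * G) - A * y ^ k             ≡⟨ cong (λ t → y ^ k * (A + t * G) - A * y ^ k) x≡M^s+1*y ⟩
        y ^ k * (A + M * M ^ s * y * G) - A * y ^ k
          ≡⟨ solve 6 (λ Y A M P Z G → Y :* (A :+ M :* P :* Z :* G) :- A :* Y := P :* Z :* Y :* G :* M)
                     refl (y ^ k) A M (M ^ s) y G ⟩
        M ^ s * y * y ^ k * G * M                   ∎)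
        where open ≡-Reasoning
      M∤w : ¬ (M ∣ₛ w)
      M∤w M∣w = M∤A*y^k y M∤y (subst (M ∣ₛ_) (solve 2 (λ W Z → W :- (W :- Z) := Z) refl w (A * y ^ k))
                                            (Signed.∣m∣n⇒∣m-n M∣w M∣w-Ay^k))

    f[0]≡0 : f (+ 0) ≡ + 0
    f[0]≡0 = trans (proj₂ (factor (+ 0))) (cong (_* _) (0^n≡0 k≥1))
      where
      0^n≡0 : ∀ {n} → 1 ≤ n → (+ 0) ^ n ≡ + 0
      0^n≡0 (s≤s _) = refl

    f≡M^p*u⇒x≢0 : ∀ x p u → f x ≡ M ^ p * u → u ≢ + 0 → x ≢ + 0
    f≡M^p*u⇒x≢0 x p u fx≡ u≢0 refl =
      u≢0 (M^n*-cancelˡ p (trans (sym fx≡) (trans f[0]≡0 (sym (ℤP.*-zeroʳ (M ^ p))))))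

    f≡M^p*u⇒p≡s*k : ∀ p u x → ¬ (M ∣ₛ u) → 1 ≤ p → f x ≡ M ^ p * u →
                    ∃[ s ] ∃[ y ] p ≡ s ℕ.* k × M ∣ₛ u - A * y ^ k
    f≡M^p*u⇒p≡s*k p u x M∤u p≥1 fx≡ with f-M-adic x (f≡M^p*u⇒x≢0 x p u fx≡ u≢0)
      where
      u≢0 : u ≢ + 0
      u≢0 refl = M∤u (divides (+ 0) refl)
    ... | s , y , w , _ , _ , fx≡′ , M∤w , M∣w-Ay^k =
      s , y , p≡s*k , subst (λ t → M ∣ₛ t - A * y ^ k) (sym u≡w) (M∣w-Ay^k s≥1)
      where
      both : M ^ p * u ≡ M ^ (s ℕ.* k) * w
      both = trans (sym fx≡) fx≡′
      p≡s*k : p ≡ s ℕ.* k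
      p≡s*k = ℕP.≤-antisym (M^-exponent-≤ p _ u w both M∤w) (M^-exponent-≤ _ p w u (sym both) M∤u)
      u≡w : u ≡ w
      u≡w = M^n*-cancelˡ p (trans both (cong (λ t → M ^ t * w) (sym p≡s*k)))
      s≥1 : 1 ≤ s
      s≥1 = ℕP.n≢0⇒n>0 λ { refl → ℕP.<⇒≢ p≥1 (sym p≡s*k) }

    M^T∣f[x]⇒M^s∣x : ∀ T v x → v ≢ + 0 → f x ≡ M ^ T * v →
                     ∃[ s ] ∃[ y ] T ≤ s ℕ.* k × x ≡ M ^ s * y × y ≢ + 0
    M^T∣f[x]⇒M^s∣x T v x v≢0 fx≡ with f-M-adic x x≢0
      where x≢0 = f≡M^p*u⇒x≢0 x T v fx≡ v≢0
    ... | s , y , w , x≡ , _ , fx≡′ , M∤w , _ =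
      s , y , M^-exponent-≤ T _ v w (trans (sym fx≡) fx≡′) M∤w , x≡ ,
      λ y≡0 → f≡M^p*u⇒x≢0 x T v fx≡ v≢0 (trans x≡ (trans (cong (M ^ s *_) y≡0) (ℤP.*-zeroʳ (M ^ s))))

-- Size of polynomial values

module Growth (a : ℕ → ℤ) where
  open import Data.Integer using (_+_; _*_; _-_; _^_)
  open ℕP.≤-Reasoning

  coeffSum : ℕ → ℕ
  coeffSum zero    = ∣ a 0 ∣
  coeffSum (suc n) = coeffSum n ℕ.+ ∣ a (suc n) ∣

  ∣a*x^n∣ : ∀ n x → ∣ a n * x ^ n ∣ ≡ ∣ a n ∣ ℕ.* ∣ x ∣ ℕ.^ n
  ∣a*x^n∣ n x = trans (ℤP.abs-* (a n) (x ^ n)) (cong (∣ a n ∣ ℕ.*_) (∣i^n∣≡∣i∣^n x n))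

  ∣evalUpTo∣≤ : ∀ n x → 1 ≤ ∣ x ∣ → ∣ evalUpTo a n x ∣ ≤ coeffSum n ℕ.* ∣ x ∣ ℕ.^ n
  ∣evalUpTo∣≤ zero    x _   = ℕP.≤-reflexive (sym (ℕP.*-identityʳ _))
  ∣evalUpTo∣≤ (suc n) x X≥1 = begin
    ∣ evalUpTo a n x + a (suc n) * x ^ suc n ∣
      ≤⟨ ℤP.∣i+j∣≤∣i∣+∣j∣ (evalUpTo a n x) (a (suc n) * x ^ suc n) ⟩
    ∣ evalUpTo a n x ∣ ℕ.+ ∣ a (suc n) * x ^ suc n ∣
      ≡⟨ cong (∣ evalUpTo a n x ∣ ℕ.+_) (∣a*x^n∣ (suc n) x) ⟩
    ∣ evalUpTo a n x ∣ ℕ.+ ∣ a (suc n) ∣ ℕ.* X ℕ.^ suc n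
      ≤⟨ ℕP.+-monoˡ-≤ _ (∣evalUpTo∣≤ n x X≥1) ⟩
    coeffSum n ℕ.* X ℕ.^ n ℕ.+ ∣ a (suc n) ∣ ℕ.* X ℕ.^ suc n
      ≤⟨ ℕP.+-monoˡ-≤ _ (ℕP.*-monoʳ-≤ (coeffSum n) (ℕP.m≤n*m (X ℕ.^ n) X {{ℕ.>-nonZero X≥1}})) ⟩
    coeffSum n ℕ.* X ℕ.^ suc n ℕ.+ ∣ a (suc n) ∣ ℕ.* X ℕ.^ suc n
      ≡⟨ sym (ℕP.*-distribʳ-+ (X ℕ.^ suc n) (coeffSum n) _) ⟩
    coeffSum (suc n) ℕ.* X ℕ.^ suc n ∎
    where X = ∣ x ∣

  -- |x|^{d′+1} ≤ |a_{d′+1} x^{d′+1}| ≤ |f(x)| + coeffSum d′ · |x|^{d′}.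
  ∣evalUpTo∣≥ : ∀ d′ → a (suc d′) ≢ + 0 → ∀ x Y → 1 ≤ ∣ x ∣ → coeffSum d′ ℕ.+ Y ≤ ∣ x ∣ →
                ∣ x ∣ ℕ.^ d′ ℕ.* Y ≤ ∣ evalUpTo a (suc d′) x ∣
  ∣evalUpTo∣≥ d′ a≢0 x Y X≥1 C+Y≤X = ℕP.+-cancelˡ-≤ (C ℕ.* P) _ _ (begin
    C ℕ.* P ℕ.+ P ℕ.* Y ≡⟨ cong (ℕ._+ P ℕ.* Y) (ℕP.*-comm C P) ⟩
    P ℕ.* C ℕ.+ P ℕ.* Y ≡⟨ sym (ℕP.*-distribˡ-+ P C Y) ⟩
    P ℕ.* (C ℕ.+ Y)     ≤⟨ ℕP.*-monoʳ-≤ P C+Y≤X ⟩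
    P ℕ.* X             ≡⟨ ℕP.*-comm P X ⟩
    X ℕ.^ suc d′        ≤⟨ ℕP.m≤n*m (X ℕ.^ suc d′) ∣ a (suc d′) ∣ {{ℕ.≢-nonZero (a≢0 ∘ ℤP.∣i∣≡0⇒i≡0)}} ⟩
    ∣ a (suc d′) ∣ ℕ.* X ℕ.^ suc d′ ≡⟨ sym (∣a*x^n∣ (suc d′) x) ⟩
    ∣ a (suc d′) * x ^ suc d′ ∣
      ≡⟨ cong ∣_∣ (solve 2 (λ E T → T := E :+ T :- E) refl (evalUpTo a d′ x) (a (suc d′) * x ^ suc d′)) ⟩
    ∣ F - E ∣           ≤⟨ ℤP.∣i-j∣≤∣i∣+∣j∣ F E ⟩
    ∣ F ∣ ℕ.+ ∣ E ∣     ≡⟨ ℕP.+-comm ∣ F ∣ ∣ E ∣ ⟩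
    ∣ E ∣ ℕ.+ ∣ F ∣     ≤⟨ ℕP.+-monoˡ-≤ _ (∣evalUpTo∣≤ d′ x X≥1) ⟩
    C ℕ.* P ℕ.+ ∣ F ∣   ∎)
    where
    open Data.Integer.Solver.+-*-Solver
    X = ∣ x ∣
    C = coeffSum d′
    P = X ℕ.^ d′
    E = evalUpTo a d′ x
    F = evalUpTo a (suc d′) x

-- Counting

module _ where
  open import Data.Nat using (_+_; _*_)

  χ : Bool → ℕ
  χ true  = 1
  χ false = 0

  count : (ℕ → Bool) → ℕ → ℕ
  count P zero    = 0
  count P (suc n) = χ (P 0) + count (λ i → P (suc i)) n

  count-+ : ∀ P a b → count P (a + b) ≡ count P a + count (λ i → P (a + i)) b
  count-+ P zero    b = refl
  count-+ P (suc a) b = trans (cong (λ t → χ (P 0) + t) (count-+ (λ i → P (suc i)) a b)) (sym (ℕP.+-assoc (χ (P 0)) _ _))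

  count-cong : ∀ {P Q} n → (∀ i → i < n → P i ≡ Q i) → count P n ≡ count Q n
  count-cong zero    P≗Q = refl
  count-cong (suc n) P≗Q = cong₂ _+_ (cong χ (P≗Q 0 (s≤s z≤n))) (count-cong n (λ i i<n → P≗Q (suc i) (s≤s i<n)))

  count-mono : ∀ P {a b} → a ≤ b → count P a ≤ count P b
  count-mono P {a} {b} a≤b = subst (λ t → count P a ≤ count P t) (ℕP.m+[n∸m]≡n a≤b)
    (subst (count P a ≤_) (sym (count-+ P a (b ℕ.∸ a))) (ℕP.m≤m+n _ _))

  count-const : ∀ b n → count (λ _ → b) n ≡ χ b * n
  count-const b zero    = sym (ℕP.*-zeroʳ (χ b))
  count-const b (suc n) = trans (cong (λ t → χ b + t) (count-const b n)) (sym (ℕP.*-suc (χ b) n))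

  count-<ᵇ : ∀ B → count (ℕ._<ᵇ B) B ≡ B
  count-<ᵇ B = trans (count-cong B (λ i i<B → Equivalence.to T-≡ (ℕP.<⇒<ᵇ i<B)))
                     (trans (count-const true B) (ℕP.*-identityˡ B))

  count-≡ᵇ0 : ∀ n → 1 ≤ n → count (ℕ._≡ᵇ 0) n ≡ 1
  count-≡ᵇ0 (suc n) _ = cong suc (count-const false n)

  χ-∧ : ∀ x y → χ (x ∧ y) ≡ χ x * χ y
  χ-∧ true  y = sym (ℕP.+-identityʳ _)
  χ-∧ false y = refl

  count-∧-const : ∀ Q b n → count (λ i → Q i ∧ b) n ≡ count Q n * χ b
  count-∧-const Q b zero    = refl
  count-∧-const Q b (suc n) = trans (cong₂ _+_ (χ-∧ (Q 0) b) (count-∧-const (λ i → Q (suc i)) b n))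
                                    (sym (ℕP.*-distribʳ-+ (χ b) (χ (Q 0)) _))

  count-digit : ∀ c .{{_ : ℕ.NonZero c}} Q P X →
                count (λ n → Q (n % c) ∧ P (n / c)) (c * X) ≡ count Q c * count P X
  count-digit c Q P zero    = trans (cong (count _) (ℕP.*-zeroʳ c)) (sym (ℕP.*-zeroʳ (count Q c)))
  count-digit c Q P (suc X) = begin
    count R (c * suc X)                                     ≡⟨ cong (count R) (ℕP.*-suc c X) ⟩
    count R (c + c * X)                                     ≡⟨ count-+ R c (c * X) ⟩
    count R c + count (λ i → R (c + i)) (c * X)             ≡⟨ cong₂ _+_ first-block other-blocks ⟩
    count Q c * χ (P 0) + count Q c * count (λ i → P (suc i)) X ≡⟨ sym (ℕP.*-distribˡ-+ (count Q c) _ _) ⟩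
    count Q c * count P (suc X)                             ∎
    where
    open ≡-Reasoning
    R = λ n → Q (n % c) ∧ P (n / c)
    first-block : count R c ≡ count Q c * χ (P 0)
    first-block = trans (count-cong c (λ i i<c → cong₂ (λ u v → Q u ∧ P v) (m<n⇒m%n≡m i<c) (m<n⇒m/n≡0 i<c)))
                        (count-∧-const Q (P 0) c)
    shift : ∀ i → R (c + i) ≡ Q (i % c) ∧ P (suc (i / c))
    shift i = cong₂ (λ u v → Q u ∧ P v) (trans (cong (_% c) (ℕP.+-comm c i)) ([m+n]%n≡m%n i c))
                    (trans (m/n≡1+[m∸n]/n (ℕP.m≤m+n c i)) (cong (λ t → suc (t / c)) (ℕP.m+n∸m≡n c i)))
    other-blocks : count (λ i → R (c + i)) (c * X) ≡ count Q c * count (λ i → P (suc i)) X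
    other-blocks = trans (count-cong (c * X) (λ i _ → shift i)) (count-digit c Q (λ i → P (suc i)) X)

  ∣S∣≡count : ∀ {n} (S : Subset n) (P : ℕ → Bool) → (∀ i → lookup S i ≡ P (toℕ i)) → ∣ S ∣ₛ ≡ count P n
  ∣S∣≡count []      P S≗P = refl
  ∣S∣≡count (s ∷ S) P S≗P with P 0 | S≗P Fin.zero
  ... | true  | refl = cong suc (∣S∣≡count S (λ i → P (suc i)) (λ i → S≗P (Fin.suc i)))
  ... | false | refl = ∣S∣≡count S (λ i → P (suc i)) (λ i → S≗P (Fin.suc i))

  ∣tabulate∣≡count : ∀ N (P : ℕ → Bool) → ∣ tabulate (λ (i : Fin N) → P (toℕ i)) ∣ₛ ≡ count P N
  ∣tabulate∣≡count N P = ∣S∣≡count (tabulate P′) P (VecP.lookup∘tabulate P′)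
    where
    P′ : Fin N → Bool
    P′ i = P (toℕ i)

  ∈tabulate⇒T : ∀ {N} (g : Fin N → Bool) i → i ∈ tabulate g → T (g i)
  ∈tabulate⇒T g i i∈ = Equivalence.from T-≡ (trans (sym (VecP.lookup∘tabulate g i)) (VecP.[]=⇒lookup i∈))

module _ where
  open import Data.Nat using (_+_; _*_; _^_)
  open ℕP.≤-Reasoning

  [m*n]^o≡m^o*n^o : ∀ a b n → (a * b) ^ n ≡ a ^ n * b ^ n
  [m*n]^o≡m^o*n^o a b zero    = refl
  [m*n]^o≡m^o*n^o a b (suc n) rewrite [m*n]^o≡m^o*n^o a b n =
    solve 4 (λ a b x y → a :* b :* (x :* y) := a :* x :* (b :* y)) refl a b (a ^ n) (b ^ n)
    where open Data.Nat.Solver.+-*-Solver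

  n<m^n : ∀ m → 2 ≤ m → ∀ n → n < m ^ n
  n<m^n m m≥2 zero    = s≤s z≤n
  n<m^n m m≥2 (suc n) = ℕP.<-≤-trans (s≤s n<m^n′) (begin
    suc (m ^ n)   ≤⟨ ℕP.+-monoˡ-≤ (m ^ n) (ℕP.≤-trans (s≤s z≤n) n<m^n′) ⟩
    m ^ n + m ^ n ≡⟨ cong (λ t → m ^ n + t) (sym (ℕP.+-identityʳ (m ^ n))) ⟩
    2 * m ^ n     ≤⟨ ℕP.*-monoˡ-≤ (m ^ n) m≥2 ⟩
    m * m ^ n     ∎)
    where n<m^n′ = n<m^n m m≥2 n

  ^-cancelʳ-≤ : ∀ m → 2 ≤ m → ∀ p q → m ^ p ≤ m ^ q → p ≤ q
  ^-cancelʳ-≤ m m≥2 p q m^p≤m^q with p ℕP.≤? q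
  ... | yes p≤q = p≤q
  ... | no p≰q  = ⊥-elim (ℕP.<⇒≱ (ℕP.^-monoʳ-< m m≥2 (ℕP.≰⇒> p≰q)) m^p≤m^q)

  bracket-by-powers : ∀ K b → 1 ≤ K → 2 ≤ b → ∀ N → K ≤ N → ∃[ J ] K * b ^ J ≤ N × N < K * b ^ suc J
  bracket-by-powers K b K≥1 b≥2 zero K≤0 = ⊥-elim (ℕP.<⇒≱ K≥1 K≤0)
  bracket-by-powers K b K≥1 b≥2 (suc N) K≤N+1 with K ℕP.≤? N
  ... | no K≰N = 0 , ℕP.≤-trans (ℕP.≤-reflexive (ℕP.*-identityʳ K)) K≤N+1 , (begin-strict
    suc N     ≡⟨ sym K≡N+1 ⟩
    K         <⟨ ℕP.m<m*n K b {{ℕ.>-nonZero K≥1}} b≥2 ⟩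
    K * b     ≡⟨ cong (K *_) (sym (ℕP.*-identityʳ b)) ⟩
    K * b ^ 1 ∎)
    where K≡N+1 = ℕP.≤-antisym K≤N+1 (ℕP.≰⇒> K≰N)
  ... | yes K≤N with bracket-by-powers K b K≥1 b≥2 N K≤N
  ...   | J , lo , hi with suc N ℕP.<? K * b ^ suc J
  ...     | yes N+1<  = J , ℕP.m≤n⇒m≤1+n lo , N+1<
  ...     | no N+1≮ = suc J , ℕP.≤-reflexive (sym N+1≡) , (begin-strict
    suc N             ≡⟨ N+1≡ ⟩
    K * b ^ suc J     <⟨ ℕP.*-monoʳ-< K {{ℕ.>-nonZero K≥1}} (ℕP.m<m*n (b ^ suc J) b {{b^J+1≢0}} b≥2) ⟩
    K * (b ^ suc J * b) ≡⟨ cong (K *_) (ℕP.*-comm (b ^ suc J) b) ⟩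
    K * b ^ suc (suc J) ∎)
    where
    N+1≡ : suc N ≡ K * b ^ suc J
    N+1≡ = ℕP.≤-antisym hi (ℕP.≮⇒≥ N+1≮)
    b^J+1≢0 : ℕ.NonZero (b ^ suc J)
    b^J+1≢0 = ℕP.m^n≢0 b (suc J) {{ℕ.>-nonZero (ℕP.≤-trans (s≤s z≤n) b≥2)}}

-- Digit patterns

data DigitKind : Set where
  zeroDigit freeDigit residueDigit : DigitKind

module Construction (m : ℕ) (m≥2 : 2 ≤ m) (sf : SquareFree m)
                    (k′ : ℕ) (A : ℤ) (cop : Coprime ∣ A ∣ m) (f : ℤ → ℤ)
                    (factor : ∀ x → ∃[ G ] f x ≡ x ℤ.^ suc k′ ℤ.* (A ℤ.+ x ℤ.* G))
                    (onlyRoot : ∀ x → + m ∣ₛ f x → + m ∣ₛ x)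
                    (R : Subset m)
                    (R-noKthPower : ∀ r r′ → r ∈ R → r′ ∈ R → r ≢ r′ →
                                    ∀ x → ¬ ((+ toℕ r) ℤ.- (+ toℕ r′) ≡ x ℤ.^ suc k′ [mod m ]))
                    (B : ℕ) where
  open import Data.Integer using (_+_; _*_; _-_; -_; _^_)
  open Data.Integer.Solver.+-*-Solver
  open MAdic m m≥2 sf

  k : ℕ
  k = suc k′

  open Valuation k (s≤s z≤n) A cop f factor onlyRoot

  instance
    m-nonTrivial : ℕ.NonTrivial m
    m-nonTrivial = ℕ.n>1⇒nonTrivial m≥2
    m-nonZero : ℕ.NonZero m
    m-nonZero = ℕ.nonTrivial⇒nonZero m

  c : ℕ
  c = ∣ A ∣

  C : ℤ
  C = + c

  instance
    c-nonZero : ℕ.NonZero c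
    c-nonZero = ℕ.≢-nonZero λ c≡0 → Coprimality.¬0-coprimeTo-2+ (subst (λ t → Coprime t m) c≡0 cop)

  inR : ℕ → Bool
  inR e with e ℕP.<? m
  ... | yes e<m = lookup R (fromℕ< e<m)
  ... | no _    = false

  inR-sound : ∀ e → T (inR e) → ∃[ r ] toℕ r ≡ e × r ∈ R
  inR-sound e h with e ℕP.<? m
  ... | yes e<m = fromℕ< e<m , FinP.toℕ-fromℕ< e<m , VecP.lookup⇒[]= (fromℕ< e<m) R (Equivalence.to T-≡ h)

  lookup-R : ∀ i → lookup R i ≡ inR (toℕ i)
  lookup-R i with toℕ i ℕP.<? m
  ... | yes i<m = cong (lookup R) (sym (FinP.fromℕ<-toℕ i i<m))
  ... | no i≮m  = ⊥-elim (i≮m (FinP.toℕ<n i))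

  allowed : DigitKind → ℕ → Bool
  allowed zeroDigit    e = e ℕ.≡ᵇ 0
  allowed freeDigit    e = true
  allowed residueDigit e = inR e

  -- Base-m digits, least significant first; the number left after the pattern must be below B.
  Digits : List DigitKind → ℕ → Bool
  Digits []      ν = ν ℕ.<ᵇ B
  Digits (κ ∷ K) ν = allowed κ (ν % m) ∧ Digits K (ν / m)

  PositionOK : ℕ → DigitKind → Set
  PositionOK p zeroDigit    = ⊤
  PositionOK p freeDigit    = ∀ s → p ≢ s ℕ.* k
  PositionOK p residueDigit = 1 ≤ p

  Admissible : ℕ → List DigitKind → Set
  Admissible p []      = ⊤
  Admissible p (κ ∷ K) = PositionOK p κ × Admissible (suc p) K

  HighDigitsOK : ℕ → Set
  HighDigitsOK q = ∀ ν ν′ → ν < B → ν′ < B → ν ≢ ν′ → ∀ x → f x ≢ M ^ q * (C * (+ ν - + ν′))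

  digit-split : ∀ ν ν′ → + ν - + ν′ ≡ (+ (ν % m) - + (ν′ % m)) + M * (+ (ν / m) - + (ν′ / m))
  digit-split ν ν′ = trans (cong₂ _-_ (lastDigit ν) (lastDigit ν′))
    (solve 5 (λ E E′ U U′ X → E :+ U :* X :- (E′ :+ U′ :* X) := E :- E′ :+ X :* (U :- U′))
             refl (+ (ν % m)) (+ (ν′ % m)) (+ (ν / m)) (+ (ν′ / m)) M)
    where
    lastDigit : ∀ ν → + ν ≡ + (ν % m) + + (ν / m) * M
    lastDigit ν = trans (cong +_ (m≡m%n+[m/n]*n ν m))
                        (trans (ℤP.pos-+ (ν % m) _) (cong (λ t → + (ν % m) + t) (ℤP.pos-* (ν / m) m)))

  M∤C*[e-e′+M*D] : ∀ {e e′} → e < m → e′ < m → e ≢ e′ → ∀ D → ¬ (M ∣ₛ C * ((+ e - + e′) + M * D))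
  M∤C*[e-e′+M*D] e<m e′<m e≢e′ D M∣ = e≢e′ (M∣[e-e′]⇒e≡e′ e<m e′<m
    (Signed.∣m+n∣n⇒∣m (coprime∧M∣*⇒M∣ C _ cop M∣) (divides D (ℤP.*-comm M D))))

  M∣C*X+M*W⇒M∣X : ∀ X W → M ∣ₛ C * X + M * W → M ∣ₛ X
  M∣C*X+M*W⇒M∣X X W M∣ = coprime∧M∣*⇒M∣ C X cop (Signed.∣m+n∣n⇒∣m M∣ (divides W (ℤP.*-comm M W)))

  residues-differ : ∀ {e e′} → T (inR e) → T (inR e′) → e ≢ e′ →
                    ∀ y D → ¬ (M ∣ₛ C * ((+ e - + e′) + M * D) - A * y ^ k)
  residues-differ {e} {e′} e∈R e′∈R e≢e′ y D M∣
    with inR-sound e e∈R | inR-sound e′ e′∈R | ℤP.+∣i∣≡i⊎+∣i∣≡-i A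
  ... | r , refl , r∈R | r′ , refl , r′∈R | inj₁ C≡A =
    R-noKthPower r r′ r∈R r′∈R (e≢e′ ∘ cong toℕ) y
      (Signed.∣⇒∣ᵤ (M∣C*X+M*W⇒M∣X (E - y ^ k) (C * D) (subst (M ∣ₛ_) eq M∣)))
    where
    E = + e - + e′
    eq : C * (E + M * D) - A * y ^ k ≡ C * (E - y ^ k) + M * (C * D)
    eq = trans (cong (λ t → C * (E + M * D) - t * y ^ k) (sym C≡A))
      (solve 5 (λ C E X D Y → C :* (E :+ X :* D) :- C :* Y := C :* (E :- Y) :+ X :* (C :* D)) refl C E M D (y ^ k))
  ... | r , refl , r∈R | r′ , refl , r′∈R | inj₂ C≡-A =
    R-noKthPower r′ r r′∈R r∈R (e≢e′ ∘ sym ∘ cong toℕ) y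
      (Signed.∣⇒∣ᵤ (subst (M ∣ₛ_) (solve 3 (λ E E′ Y → :- (E :- E′ :+ Y) := E′ :- E :- Y) refl (+ e) (+ e′) (y ^ k))
                                 (Signed.∣m⇒∣-m (M∣C*X+M*W⇒M∣X (E + y ^ k) (C * D) (subst (M ∣ₛ_) eq M∣)))))
    where
    E = + e - + e′
    A≡-C : A ≡ - C
    A≡-C = trans (sym (ℤP.neg-involutive A)) (cong -_ (sym C≡-A))
    eq : C * (E + M * D) - A * y ^ k ≡ C * (E + y ^ k) + M * (C * D)
    eq = trans (cong (λ t → C * (E + M * D) - t * y ^ k) A≡-C)
      (solve 5 (λ C E X D Y → C :* (E :+ X :* D) :- (:- C) :* Y := C :* (E :+ Y) :+ X :* (C :* D)) refl C E M D (y ^ k))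

  lowest-digits-differ : ∀ p κ → PositionOK p κ → ∀ {e e′} → e < m → e′ < m →
                         T (allowed κ e) → T (allowed κ e′) → e ≢ e′ →
                         ∀ x D → f x ≢ M ^ p * (C * ((+ e - + e′) + M * D))
  lowest-digits-differ p zeroDigit _ _ _ e≡0 e′≡0 e≢e′ x D _ =
    e≢e′ (trans (ℕP.≡ᵇ⇒≡ _ 0 e≡0) (sym (ℕP.≡ᵇ⇒≡ _ 0 e′≡0)))
  lowest-digits-differ p freeDigit p∉kℕ e<m e′<m _ _ e≢e′ x D fx≡
    with f≡M^p*u⇒p≡s*k p _ x (M∤C*[e-e′+M*D] e<m e′<m e≢e′ D) (ℕP.n≢0⇒n>0 (p∉kℕ 0)) fx≡
  ... | s , _ , p≡s*k , _ = p∉kℕ s p≡s*k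
  lowest-digits-differ p residueDigit p≥1 e<m e′<m e∈R e′∈R e≢e′ x D fx≡
    with f≡M^p*u⇒p≡s*k p _ x (M∤C*[e-e′+M*D] e<m e′<m e≢e′ D) p≥1 fx≡
  ... | _ , y , _ , M∣u-Ay^k = residues-differ e∈R e′∈R e≢e′ y D M∣u-Ay^k

  digits-difference : ∀ K p → Admissible p K → HighDigitsOK (p ℕ.+ length K) →
                      ∀ ν ν′ → T (Digits K ν) → T (Digits K ν′) → ν ≢ ν′ →
                      ∀ x → f x ≢ M ^ p * (C * (+ ν - + ν′))
  digits-difference [] p _ high ν ν′ ν<B ν′<B ν≢ν′ x =
    subst (λ q → f x ≢ M ^ q * (C * (+ ν - + ν′))) (ℕP.+-identityʳ p)
          (high ν ν′ (ℕP.<ᵇ⇒< ν B ν<B) (ℕP.<ᵇ⇒< ν′ B ν′<B) ν≢ν′ x)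
  digits-difference (κ ∷ K) p (ok , admissible) high ν ν′ hν hν′ ν≢ν′ x fx≡
    with Equivalence.to T-∧ hν | Equivalence.to T-∧ hν′ | ν % m ℕ.≟ ν′ % m
  ... | eν , _ | eν′ , _ | no e≢e′ =
    lowest-digits-differ p κ ok (m%n<n ν m) (m%n<n ν′ m) eν eν′ e≢e′ x (+ (ν / m) - + (ν′ / m))
      (trans fx≡ (cong (λ t → M ^ p * (C * t)) (digit-split ν ν′)))
  ... | _ , restν | _ , restν′ | yes e≡e′ =
    digits-difference K (suc p) admissible (subst HighDigitsOK (ℕP.+-suc p (length K)) high)
      (ν / m) (ν′ / m) restν restν′ μ≢μ′ x (begin
      f x                                          ≡⟨ fx≡ ⟩
      M ^ p * (C * (+ ν - + ν′))                   ≡⟨ cong (λ t → M ^ p * (C * t)) (digit-split ν ν′) ⟩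
      M ^ p * (C * ((+ e - + e′) + M * D))         ≡⟨ cong (λ t → M ^ p * (C * ((+ e - + t) + M * D))) (sym e≡e′) ⟩
      M ^ p * (C * ((+ e - + e) + M * D))          ≡⟨ solve 5 (λ P C E X D → P :* (C :* (E :- E :+ X :* D)) := X :* P :* (C :* D))
                                                            refl (M ^ p) C (+ e) M D ⟩
      M ^ suc p * (C * D)                          ∎)
    where
    open ≡-Reasoning
    e = ν % m
    e′ = ν′ % m
    D = + (ν / m) - + (ν′ / m)
    μ≢μ′ : ν / m ≢ ν′ / m
    μ≢μ′ μ≡μ′ = ν≢ν′ (trans (m≡m%n+[m/n]*n ν m)
                     (trans (cong₂ (λ u v → u ℕ.+ v ℕ.* m) e≡e′ μ≡μ′) (sym (m≡m%n+[m/n]*n ν′ m))))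

  patternCount : List DigitKind → ℕ
  patternCount []      = 1
  patternCount (κ ∷ K) = count (allowed κ) m ℕ.* patternCount K

  count-Digits : ∀ K → count (Digits K) (m ℕ.^ length K ℕ.* B) ≡ patternCount K ℕ.* B
  count-Digits []      = trans (cong (count (ℕ._<ᵇ B)) (ℕP.*-identityˡ B))
                               (trans (count-<ᵇ B) (sym (ℕP.*-identityˡ B)))
  count-Digits (κ ∷ K) = begin
    count (Digits (κ ∷ K)) (m ℕ.* m ℕ.^ length K ℕ.* B)   ≡⟨ cong (count (Digits (κ ∷ K))) (ℕP.*-assoc m _ B) ⟩
    count (Digits (κ ∷ K)) (m ℕ.* (m ℕ.^ length K ℕ.* B)) ≡⟨ count-digit m (allowed κ) (Digits K) _ ⟩
    count (allowed κ) m ℕ.* count (Digits K) (m ℕ.^ length K ℕ.* B) ≡⟨ cong (count (allowed κ) m ℕ.*_) (count-Digits K) ⟩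
    count (allowed κ) m ℕ.* (patternCount K ℕ.* B)        ≡⟨ sym (ℕP.*-assoc (count (allowed κ) m) _ B) ⟩
    patternCount (κ ∷ K) ℕ.* B                            ∎
    where open ≡-Reasoning

  patternCount-free++ : ∀ n K → patternCount (replicate n freeDigit ++ K) ≡ m ℕ.^ n ℕ.* patternCount K
  patternCount-free++ zero    K = sym (ℕP.*-identityˡ _)
  patternCount-free++ (suc n) K = trans (cong₂ ℕ._*_ (trans (count-const true m) (ℕP.*-identityˡ m)) (patternCount-free++ n K))
                                        (sym (ℕP.*-assoc m _ _))

  admissible-free++ : ∀ n p K → (∀ i → i < n → ∀ s → p ℕ.+ i ≢ s ℕ.* k) → Admissible (p ℕ.+ n) K →
                      Admissible p (replicate n freeDigit ++ K)
  admissible-free++ zero    p K _ adm = subst (λ q → Admissible q K) (ℕP.+-identityʳ p) adm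
  admissible-free++ (suc n) p K p+i∉kℕ adm =
    (λ s p≡sk → p+i∉kℕ 0 (s≤s z≤n) s (trans (ℕP.+-identityʳ p) p≡sk)) ,
    admissible-free++ n (suc p) K (λ i i<n s eq → p+i∉kℕ (suc i) (s≤s i<n) s (trans (ℕP.+-suc p i) eq))
                      (subst (λ q → Admissible q K) (ℕP.+-suc p n) adm)

  blocks : ℕ → List DigitKind
  blocks zero    = []
  blocks (suc L) = replicate k′ freeDigit ++ residueDigit ∷ blocks L

  length-blocks : ∀ L → length (blocks L) ≡ k ℕ.* L
  length-blocks zero    = sym (ℕP.*-zeroʳ k)
  length-blocks (suc L) = begin
    length (replicate k′ freeDigit ++ residueDigit ∷ blocks L) ≡⟨ ListP.length-++ (replicate k′ freeDigit) ⟩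
    length (replicate k′ freeDigit) ℕ.+ suc (length (blocks L))
                                                               ≡⟨ cong₂ (λ a b → a ℕ.+ suc b) (ListP.length-replicate k′) (length-blocks L) ⟩
    k′ ℕ.+ suc (k ℕ.* L)                                       ≡⟨ ℕP.+-suc k′ (k ℕ.* L) ⟩
    k ℕ.+ k ℕ.* L                                              ≡⟨ sym (ℕP.*-suc k L) ⟩
    k ℕ.* suc L                                                ∎
    where open ≡-Reasoning

  patternCount-blocks : ∀ L → patternCount (blocks L) ≡ (m ℕ.^ k′ ℕ.* ∣ R ∣ₛ) ℕ.^ L
  patternCount-blocks zero    = refl
  patternCount-blocks (suc L) = begin
    patternCount (replicate k′ freeDigit ++ residueDigit ∷ blocks L)         ≡⟨ patternCount-free++ k′ _ ⟩
    m ℕ.^ k′ ℕ.* (count inR m ℕ.* patternCount (blocks L))                   ≡⟨ cong₂ (λ u v → m ℕ.^ k′ ℕ.* (u ℕ.* v))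
                                                                                       (sym (∣S∣≡count R inR lookup-R)) (patternCount-blocks L) ⟩
    m ℕ.^ k′ ℕ.* (∣ R ∣ₛ ℕ.* (m ℕ.^ k′ ℕ.* ∣ R ∣ₛ) ℕ.^ L)                   ≡⟨ sym (ℕP.*-assoc (m ℕ.^ k′) _ _) ⟩
    (m ℕ.^ k′ ℕ.* ∣ R ∣ₛ) ℕ.^ suc L                                         ∎
    where open ≡-Reasoning

  not-multiple : ∀ j i → i < k′ → ∀ s → suc (k ℕ.* j) ℕ.+ i ≢ s ℕ.* k
  not-multiple j i i<k′ s eq = ℕP.1+n≢0 (begin
    suc i                               ≡⟨ sym (m<n⇒m%n≡m (s≤s i<k′)) ⟩
    suc i % k                           ≡⟨ sym ([m+kn]%n≡m%n (suc i) j k) ⟩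
    (suc i ℕ.+ j ℕ.* k) % k             ≡⟨ cong (_% k) (trans (cong (suc i ℕ.+_) (ℕP.*-comm j k)) (ℕP.+-comm (suc i) (k ℕ.* j))) ⟩
    (k ℕ.* j ℕ.+ suc i) % k             ≡⟨ cong (_% k) (trans (ℕP.+-suc (k ℕ.* j) i) eq) ⟩
    (s ℕ.* k) % k                       ≡⟨ m*n%n≡0 s k ⟩
    0                                   ∎)
    where open ≡-Reasoning

  admissible-blocks : ∀ L j → Admissible (suc (k ℕ.* j)) (blocks L)
  admissible-blocks zero    j = tt
  admissible-blocks (suc L) j = admissible-free++ k′ (suc (k ℕ.* j)) (residueDigit ∷ blocks L) (not-multiple j)
    (s≤s z≤n , subst (λ q → Admissible q (blocks L)) next-block (admissible-blocks L (suc j)))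
    where
    next-block : suc (k ℕ.* suc j) ≡ suc (suc (k ℕ.* j) ℕ.+ k′)
    next-block = cong suc (trans (ℕP.*-suc k j) (cong suc (ℕP.+-comm k′ (k ℕ.* j))))

  -- Position 0 holds the digit 0; block j fills positions kj+1, …, kj+k, the last one (a multiple of k) from R.
  digitPattern : ℕ → List DigitKind
  digitPattern L = zeroDigit ∷ blocks L

  length-digitPattern : ∀ L → length (digitPattern L) ≡ suc (k ℕ.* L)
  length-digitPattern L = cong suc (length-blocks L)

  patternCount-digitPattern : ∀ L → patternCount (digitPattern L) ≡ (m ℕ.^ k′ ℕ.* ∣ R ∣ₛ) ℕ.^ L
  patternCount-digitPattern L = trans (cong₂ ℕ._*_ (count-≡ᵇ0 m (ℕP.≤-trans (s≤s z≤n) m≥2)) (patternCount-blocks L))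
                                      (ℕP.*-identityˡ _)

  -- Scaling by c = |a_k| makes a digit difference comparable with the residue a_k y^k of f(x) / M^p.
  inA : ℕ → ℕ → Bool
  inA L n = (n % c ℕ.≡ᵇ 0) ∧ Digits (digitPattern L) (n / c)

  count-inA : ∀ L → count (inA L) (c ℕ.* (m ℕ.^ length (digitPattern L) ℕ.* B)) ≡ (m ℕ.^ k′ ℕ.* ∣ R ∣ₛ) ℕ.^ L ℕ.* B
  count-inA L = begin
    count (inA L) (c ℕ.* (m ℕ.^ length (digitPattern L) ℕ.* B))
      ≡⟨ count-digit c (ℕ._≡ᵇ 0) (Digits (digitPattern L)) _ ⟩
    count (ℕ._≡ᵇ 0) c ℕ.* count (Digits (digitPattern L)) (m ℕ.^ length (digitPattern L) ℕ.* B)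
      ≡⟨ cong₂ ℕ._*_ (count-≡ᵇ0 c (ℕP.n≢0⇒n>0 (ℕ.≢-nonZero⁻¹ c))) (count-Digits (digitPattern L)) ⟩
    1 ℕ.* (patternCount (digitPattern L) ℕ.* B)
      ≡⟨ trans (ℕP.*-identityˡ _) (cong (ℕ._* B) (patternCount-digitPattern L)) ⟩
    (m ℕ.^ k′ ℕ.* ∣ R ∣ₛ) ℕ.^ L ℕ.* B ∎
    where open ≡-Reasoning

  admissible-digitPattern : ∀ L → Admissible 0 (digitPattern L)
  admissible-digitPattern L = tt , subst (λ q → Admissible (suc q) (blocks L)) (ℕP.*-zeroʳ k) (admissible-blocks L 0)

  inA⇒n≡[n/c]*c : ∀ {L n} → T (inA L n) → n ≡ n / c ℕ.* c
  inA⇒n≡[n/c]*c {L} {n} n∈A =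
    trans (m≡m%n+[m/n]*n n c) (cong (ℕ._+ n / c ℕ.* c) (ℕP.≡ᵇ⇒≡ _ 0 (proj₁ (Equivalence.to (T-∧ {n % c ℕ.≡ᵇ 0}) n∈A))))

  inA⇒Digits : ∀ {L n} → T (inA L n) → T (Digits (digitPattern L) (n / c))
  inA⇒Digits {L} {n} n∈A = proj₂ (Equivalence.to (T-∧ {n % c ℕ.≡ᵇ 0}) n∈A)

  inA-difference : ∀ L → HighDigitsOK (length (digitPattern L)) →
                   ∀ n n′ → T (inA L n) → T (inA L n′) → ∀ x → f x ≡ + n - + n′ → n ≡ n′
  inA-difference L high n n′ n∈A n′∈A x fx≡ with n / c ℕ.≟ n′ / c
  ... | yes ν≡ν′ = trans (inA⇒n≡[n/c]*c {L} n∈A) (trans (cong (ℕ._* c) ν≡ν′) (sym (inA⇒n≡[n/c]*c {L} n′∈A)))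
  ... | no ν≢ν′ = ⊥-elim (digits-difference (digitPattern L) 0 (admissible-digitPattern L) high (n / c) (n′ / c)
      (inA⇒Digits {L} n∈A) (inA⇒Digits {L} n′∈A) ν≢ν′ x (begin
      f x                           ≡⟨ fx≡ ⟩
      + n - + n′                    ≡⟨ cong₂ _-_ (cong +_ (inA⇒n≡[n/c]*c {L} n∈A)) (cong +_ (inA⇒n≡[n/c]*c {L} n′∈A)) ⟩
      + (n / c ℕ.* c) - + (n′ / c ℕ.* c) ≡⟨ cong₂ _-_ (ℤP.pos-* (n / c) c) (ℤP.pos-* (n′ / c) c) ⟩
      + (n / c) * C - + (n′ / c) * C    ≡⟨ solve 3 (λ U V X → U :* X :- V :* X := con (+ 1) :* (X :* (U :- V)))
                                                   refl (+ (n / c)) (+ (n′ / c)) C ⟩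
      M ^ 0 * (C * (+ (n / c) - + (n′ / c))) ∎))
    where open ≡-Reasoning


-- The sets A

module _ where
  open import Data.Nat using (_+_; _*_; _^_)
  open Data.Nat.Solver.+-*-Solver

  exponent-gap : ∀ k′ e J E → 1 ≤ e → suc (suc k′ * (J + E)) + E + e * J ≤ suc (J + E) * (k′ + e) + (J + E)
  exponent-gap k′ (suc e″) J E _ = ℕP.≤-trans (ℕP.m≤m+n _ (e″ * E + k′ + e″)) (ℕP.≤-reflexive
    (solve 4 (λ k′ e″ J E → con 1 :+ (con 1 :+ k′) :* (J :+ E) :+ E :+ (con 1 :+ e″) :* J :+ (e″ :* E :+ k′ :+ e″)
                          := (con 1 :+ J :+ E) :* (k′ :+ (con 1 :+ e″)) :+ (J :+ E)) refl k′ e″ J E))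

  power-exchange : ∀ m ρ d′ p q J → m ^ p ≤ ρ ^ q →
                   ((m ^ suc d′) ^ J) ^ (d′ * q + p) ≤ ((m ^ d′ * ρ) ^ J) ^ (suc d′ * q)
  power-exchange m ρ d′ p q J m^p≤ρ^q = begin
    ((m ^ d) ^ J) ^ (d′ * q + p)          ≡⟨ trans (cong (_^ (d′ * q + p)) (ℕP.^-*-assoc m d J)) (ℕP.^-*-assoc m (d * J) _) ⟩
    m ^ (d * J * (d′ * q + p))            ≡⟨ cong (m ^_) (solve 4 (λ d′ J q p → (con 1 :+ d′) :* J :* (d′ :* q :+ p)
                                                         := d′ :* (J :* ((con 1 :+ d′) :* q)) :+ p :* (J :* (con 1 :+ d′))) refl d′ J q p) ⟩
    m ^ (d′ * t + p * (J * d))            ≡⟨ ℕP.^-distribˡ-+-* m (d′ * t) (p * (J * d)) ⟩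
    m ^ (d′ * t) * m ^ (p * (J * d))      ≤⟨ ℕP.*-monoʳ-≤ (m ^ (d′ * t)) (begin
      m ^ (p * (J * d))                     ≡⟨ sym (ℕP.^-*-assoc m p (J * d)) ⟩
      (m ^ p) ^ (J * d)                     ≤⟨ ℕP.^-monoˡ-≤ (J * d) m^p≤ρ^q ⟩
      (ρ ^ q) ^ (J * d)                     ≡⟨ ℕP.^-*-assoc ρ q (J * d) ⟩
      ρ ^ (q * (J * d))                     ≡⟨ cong (ρ ^_) (solve 3 (λ q J d → q :* (J :* d) := J :* (d :* q)) refl q J d) ⟩
      ρ ^ t                                 ∎) ⟩
    m ^ (d′ * t) * ρ ^ t                  ≡⟨ cong (_* ρ ^ t) (sym (ℕP.^-*-assoc m d′ t)) ⟩
    (m ^ d′) ^ t * ρ ^ t                  ≡⟨ sym ([m*n]^o≡m^o*n^o (m ^ d′) ρ t) ⟩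
    (m ^ d′ * ρ) ^ t                      ≡⟨ sym (ℕP.^-*-assoc _ J (d * q)) ⟩
    ((m ^ d′ * ρ) ^ J) ^ (d * q)          ∎
    where
    open ℕP.≤-Reasoning
    d = suc d′
    t = J * (d * q)

elem-difference : ∀ {N} (i j : Fin N) → elem i ℤ.- elem j ≡ + toℕ i ℤ.- + toℕ j
elem-difference i j = solve 2 (λ I J → con (+ 1) :+ I :- (con (+ 1) :+ J) := I :- J) refl (+ toℕ i) (+ toℕ j)
  where open Data.Integer.Solver.+-*-Solver

module LowerBound (m : ℕ) (m≥2 : 2 ≤ m) (sf : SquareFree m) (k′ e : ℕ) (a : ℕ → ℤ)
             (low : ∀ i → i < suc k′ → a i ≡ + 0) (a[d]≢0 : a (suc k′ ℕ.+ e) ≢ + 0)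
             (cop : Coprime ∣ a (suc k′) ∣ m)
             (onlyRoot : ∀ x → evalUpTo a (suc k′ ℕ.+ e) x ≡ + 0 [mod m ] → x ≡ + 0 [mod m ])
             (R : Subset m) (R≢∅ : 0 < ∣ R ∣ₛ)
             (R-noKthPower : ∀ r r′ → r ∈ R → r′ ∈ R → r ≢ r′ →
                             ∀ x → ¬ ((+ toℕ r) ℤ.- (+ toℕ r′) ≡ x ℤ.^ suc k′ [mod m ])) where
  open import Data.Nat using (_+_; _*_; _^_)

  k d d′ : ℕ
  k  = suc k′
  d  = k + e
  d′ = k′ + e

  f : ℤ → ℤ
  f = evalUpTo a d

  open MAdic m m≥2 sf using (M; m≢0)

  onlyRootₛ : ∀ x → M ∣ₛ f x → M ∣ₛ x
  onlyRootₛ x M∣fx = subst (M ∣ₛ_) (ℤP.+-identityʳ x)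
    (Signed.∣ᵤ⇒∣ (onlyRoot x (Signed.∣⇒∣ᵤ (subst (M ∣ₛ_) (sym (ℤP.+-identityʳ (f x))) M∣fx))))

  module Level (J : ℕ) = Construction m m≥2 sf k′ (a k) cop f (evalUpTo-factor a k′ low e) onlyRootₛ
                                      R R-noKthPower (m ^ (e * J))
  open MAdic.Valuation m m≥2 sf k (s≤s z≤n) (a k) cop f (evalUpTo-factor a k′ low e) onlyRootₛ
    using (M^T∣f[x]⇒M^s∣x)
  open Growth a using (coeffSum; ∣evalUpTo∣≥)

  instance
    m-nonZero : ℕ.NonZero m
    m-nonZero = ℕ.≢-nonZero m≢0

  c : ℕ
  c = ∣ a k ∣

  E : ℕ
  E = coeffSum d′ + c

  L : ℕ → ℕ
  L J = J + E

  instance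
    c-nonZero : ℕ.NonZero c
    c-nonZero = Level.c-nonZero 0

  ∣f[x]∣≥ : ∀ ℓ x → E ≤ ℓ → m ^ suc ℓ ≤ ∣ x ∣ → (m ^ suc ℓ) ^ d′ * m ^ ℓ ≤ ∣ f x ∣
  ∣f[x]∣≥ ℓ x E≤ℓ m^ℓ+1≤∣x∣ = ℕP.≤-trans (ℕP.*-monoˡ-≤ (m ^ ℓ) (ℕP.^-monoˡ-≤ d′ m^ℓ+1≤∣x∣))
                                         (∣evalUpTo∣≥ d′ a[d]≢0 x (m ^ ℓ) 1≤∣x∣ coeffSum+m^ℓ≤∣x∣)
    where
    open ℕP.≤-Reasoning
    1≤∣x∣ : 1 ≤ ∣ x ∣
    1≤∣x∣ = ℕP.≤-trans (ℕP.m^n>0 m (suc ℓ)) m^ℓ+1≤∣x∣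
    coeffSum+m^ℓ≤∣x∣ : coeffSum d′ + m ^ ℓ ≤ ∣ x ∣
    coeffSum+m^ℓ≤∣x∣ = begin
      coeffSum d′ + m ^ ℓ ≤⟨ ℕP.+-monoˡ-≤ (m ^ ℓ) (ℕP.≤-trans (ℕP.m≤m+n _ c) (ℕP.≤-trans E≤ℓ (ℕP.<⇒≤ (n<m^n m m≥2 ℓ)))) ⟩
      m ^ ℓ + m ^ ℓ       ≡⟨ cong (λ t → m ^ ℓ + t) (sym (ℕP.+-identityʳ _)) ⟩
      2 * m ^ ℓ           ≤⟨ ℕP.*-monoˡ-≤ (m ^ ℓ) m≥2 ⟩
      m ^ suc ℓ           ≤⟨ m^ℓ+1≤∣x∣ ⟩
      ∣ x ∣               ∎

  M^[kℓ+1]∣f[x]⇒m^[ℓ+1]≤∣x∣ : ∀ ℓ v x → v ≢ + 0 → f x ≡ M ℤ.^ suc (k * ℓ) ℤ.* v → m ^ suc ℓ ≤ ∣ x ∣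
  M^[kℓ+1]∣f[x]⇒m^[ℓ+1]≤∣x∣ ℓ v x v≢0 fx≡ with M^T∣f[x]⇒M^s∣x (suc (k * ℓ)) v x v≢0 fx≡
  ... | s , y , kℓ<s*k , x≡M^s*y , y≢0 = begin
    m ^ suc ℓ     ≤⟨ ℕP.^-monoʳ-≤ m ℓ<s ⟩
    m ^ s         ≤⟨ ℕP.m≤m*n (m ^ s) ∣ y ∣ {{ℕ.≢-nonZero (y≢0 ∘ ℤP.∣i∣≡0⇒i≡0)}} ⟩
    m ^ s * ∣ y ∣ ≡⟨ sym (trans (cong ∣_∣ x≡M^s*y)
                               (trans (ℤP.abs-* (M ℤ.^ s) y) (cong (_* ∣ y ∣) (∣i^n∣≡∣i∣^n M s)))) ⟩
    ∣ x ∣         ∎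
    where
    open ℕP.≤-Reasoning
    ℓ<s : ℓ < s
    ℓ<s = ℕP.*-cancelˡ-< k ℓ s (subst (k * ℓ <_) (ℕP.*-comm s k) kℓ<s*k)

  ∣M^[kL+1]*C*[ν-ν′]∣< : ∀ J → 1 ≤ e → ∀ {ν ν′} → ν < m ^ (e * J) → ν′ < m ^ (e * J) →
                         ∣ M ℤ.^ suc (k * L J) ℤ.* (+ c ℤ.* (+ ν ℤ.- + ν′)) ∣ < (m ^ suc (L J)) ^ d′ * m ^ L J
  ∣M^[kL+1]*C*[ν-ν′]∣< J 1≤e {ν} {ν′} ν<B ν′<B = begin-strict
    ∣ M ℤ.^ q ℤ.* (+ c ℤ.* (+ ν ℤ.- + ν′)) ∣
      ≡⟨ trans (ℤP.abs-* (M ℤ.^ q) _) (cong₂ _*_ (∣i^n∣≡∣i∣^n M q) (ℤP.abs-* (+ c) _)) ⟩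
    m ^ q * (c * ∣ + ν ℤ.- + ν′ ∣)
      <⟨ ℕP.*-monoʳ-< (m ^ q) {{ℕP.m^n≢0 m q}} (ℕP.*-monoʳ-< c (∣m-n∣<B ν<B ν′<B)) ⟩
    m ^ q * (c * B)
      ≤⟨ ℕP.*-monoʳ-≤ (m ^ q) (ℕP.*-monoˡ-≤ B (ℕP.<⇒≤ (ℕP.≤-<-trans (ℕP.m≤n+m c (coeffSum d′)) (n<m^n m m≥2 E)))) ⟩
    m ^ q * (m ^ E * B)
      ≡⟨ sym (trans (ℕP.^-distribˡ-+-* m (q + E) (e * J))
                    (trans (cong (_* B) (ℕP.^-distribˡ-+-* m q E)) (ℕP.*-assoc (m ^ q) (m ^ E) B))) ⟩
    m ^ (q + E + e * J)
      ≤⟨ ℕP.^-monoʳ-≤ m (exponent-gap k′ e J E 1≤e) ⟩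
    m ^ (suc (L J) * d′ + L J)
      ≡⟨ trans (ℕP.^-distribˡ-+-* m (suc (L J) * d′) (L J)) (cong (_* m ^ L J) (sym (ℕP.^-*-assoc m (suc (L J)) d′))) ⟩
    (m ^ suc (L J)) ^ d′ * m ^ L J ∎
    where
    open ℕP.≤-Reasoning
    q = suc (k * L J)
    B = m ^ (e * J)

  high-digits-ok : ∀ J → Level.HighDigitsOK J (suc (k * L J))
  high-digits-ok J ν ν′ ν<B ν′<B ν≢ν′ x fx≡ with e ℕ.≟ 0
  ... | yes e≡0 = ν≢ν′ (trans (below-1 ν<B) (sym (below-1 ν′<B)))
    where
    below-1 : ∀ {t} → t < m ^ (e * J) → t ≡ 0
    below-1 t<B = ℕP.n<1⇒n≡0 (subst (λ u → _ < m ^ (u * J)) e≡0 t<B)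
  ... | no e≢0 = ℕP.<⇒≱ (∣M^[kL+1]*C*[ν-ν′]∣< J (ℕP.n≢0⇒n>0 e≢0) ν<B ν′<B)
    (subst ((m ^ suc (L J)) ^ d′ * m ^ L J ≤_) (cong ∣_∣ fx≡)
      (∣f[x]∣≥ (L J) x (ℕP.m≤n+m E J) (M^[kℓ+1]∣f[x]⇒m^[ℓ+1]≤∣x∣ (L J) _ x v≢0 fx≡)))
    where
    v≢0 : + c ℤ.* (+ ν ℤ.- + ν′) ≢ + 0
    v≢0 v≡0 with ℤP.i*j≡0⇒i≡0∨j≡0 (+ c) v≡0
    ... | inj₁ c≡0 = ℕ.≢-nonZero⁻¹ c (ℤP.+-injective c≡0)
    ... | inj₂ ν-ν′≡0 = ν≢ν′ (ℤP.+-injective (ℤP.i-j≡0⇒i≡j _ _ ν-ν′≡0))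

  ρ : ℕ
  ρ = ∣ R ∣ₛ

  K₀ b c₂ : ℕ
  K₀ = c * m ^ suc (k * E)
  b  = m ^ d
  c₂ = K₀ * b

  K₀>0 : 0 < K₀
  K₀>0 = ℕP.*-mono-≤ (ℕP.n≢0⇒n>0 (ℕ.≢-nonZero⁻¹ c)) (ℕP.m^n>0 m (suc (k * E)))

  c₂>0 : 0 < c₂
  c₂>0 = ℕP.*-mono-≤ K₀>0 (ℕP.m^n>0 m d)

  b≥2 : 2 ≤ b
  b≥2 = ℕP.≤-trans m≥2 (ℕP.m≤m*n m (m ^ d′) {{ℕP.m^n≢0 m d′}})

  AvoidsF : ∀ {N} → Subset N → Set
  AvoidsF A = ∀ i j → i ∈ A → j ∈ A → ∀ x → elem i ℤ.- elem j ≡ evalUpTo a d x → i ≡ j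

  range-size : ∀ J → c * (m ^ length (Level.digitPattern J (L J)) * m ^ (e * J)) ≡ K₀ * b ^ J
  range-size J = begin
    c * (m ^ length (Level.digitPattern J (L J)) * m ^ (e * J))
                                                ≡⟨ cong (λ t → c * (m ^ t * m ^ (e * J))) (Level.length-digitPattern J (L J)) ⟩
    c * (m ^ suc (k * L J) * m ^ (e * J))       ≡⟨ cong (c *_) (sym (ℕP.^-distribˡ-+-* m (suc (k * L J)) (e * J))) ⟩
    c * m ^ (suc (k * L J) + e * J)             ≡⟨ cong (λ t → c * m ^ t) (solve 4 (λ J E k′ e →
                                                     con 1 :+ (con 1 :+ k′) :* (J :+ E) :+ e :* J
                                                  := con 1 :+ (con 1 :+ k′) :* E :+ (con 1 :+ k′ :+ e) :* J) refl J E k′ e) ⟩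
    c * m ^ (suc (k * E) + d * J)               ≡⟨ cong (c *_) (ℕP.^-distribˡ-+-* m (suc (k * E)) (d * J)) ⟩
    c * (m ^ suc (k * E) * m ^ (d * J))         ≡⟨ sym (ℕP.*-assoc c _ _) ⟩
    K₀ * m ^ (d * J)                            ≡⟨ cong (K₀ *_) (sym (ℕP.^-*-assoc m d J)) ⟩
    K₀ * b ^ J                                  ∎
    where
    open ≡-Reasoning
    open Data.Nat.Solver.+-*-Solver

  [m^d′*ρ]^J≤ : ∀ J → (m ^ d′ * ρ) ^ J ≤ (m ^ k′ * ρ) ^ L J * m ^ (e * J)
  [m^d′*ρ]^J≤ J = begin
    (m ^ d′ * ρ) ^ J                  ≡⟨ cong (λ t → (t * ρ) ^ J) (ℕP.^-distribˡ-+-* m k′ e) ⟩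
    (m ^ k′ * m ^ e * ρ) ^ J          ≡⟨ cong (_^ J) (solve 3 (λ x y r → x :* y :* r := x :* r :* y) refl (m ^ k′) (m ^ e) ρ) ⟩
    (m ^ k′ * ρ * m ^ e) ^ J          ≡⟨ [m*n]^o≡m^o*n^o (m ^ k′ * ρ) (m ^ e) J ⟩
    (m ^ k′ * ρ) ^ J * (m ^ e) ^ J    ≡⟨ cong ((m ^ k′ * ρ) ^ J *_) (ℕP.^-*-assoc m e J) ⟩
    (m ^ k′ * ρ) ^ J * m ^ (e * J)    ≤⟨ ℕP.*-monoˡ-≤ (m ^ (e * J)) (ℕP.^-monoʳ-≤ (m ^ k′ * ρ) {{m^k′*ρ≢0}} (ℕP.m≤m+n J E)) ⟩
    (m ^ k′ * ρ) ^ L J * m ^ (e * J)  ∎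
    where
    open ℕP.≤-Reasoning
    open Data.Nat.Solver.+-*-Solver
    m^k′*ρ≢0 : ℕ.NonZero (m ^ k′ * ρ)
    m^k′*ρ≢0 = ℕ.>-nonZero (ℕP.*-mono-≤ (ℕP.m^n>0 m k′) R≢∅)

  levelSet : ∀ N J → Subset N
  levelSet N J = tabulate (λ i → Level.inA J (L J) (toℕ i))

  levelSet-avoidsF : ∀ N J → AvoidsF (levelSet N J)
  levelSet-avoidsF N J i j i∈A j∈A x eq = FinP.toℕ-injective (Level.inA-difference J (L J) high (toℕ i) (toℕ j)
    (∈tabulate⇒T _ i i∈A) (∈tabulate⇒T _ j j∈A) x (trans (sym eq) (elem-difference i j)))
    where
    high = subst (Level.HighDigitsOK J) (sym (Level.length-digitPattern J (L J))) (high-digits-ok J)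

  levelSet-size : ∀ N J → K₀ * b ^ J ≤ N → (m ^ d′ * ρ) ^ J ≤ ∣ levelSet N J ∣ₛ
  levelSet-size N J K₀b^J≤N = begin
    (m ^ d′ * ρ) ^ J                   ≤⟨ [m^d′*ρ]^J≤ J ⟩
    (m ^ k′ * ρ) ^ L J * m ^ (e * J)   ≡⟨ sym (Level.count-inA J (L J)) ⟩
    count (Level.inA J (L J)) (c * (m ^ length (Level.digitPattern J (L J)) * m ^ (e * J)))
                                       ≤⟨ count-mono (Level.inA J (L J)) (subst (_≤ N) (sym (range-size J)) K₀b^J≤N) ⟩
    count (Level.inA J (L J)) N        ≡⟨ sym (∣tabulate∣≡count N (Level.inA J (L J))) ⟩
    ∣ levelSet N J ∣ₛ                  ∎
    where open ℕP.≤-Reasoning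

  construction : ∀ N → 0 < N → ∃[ J ] Σ (Subset N) λ A → AvoidsF A × N ≤ c₂ * b ^ J × (m ^ d′ * ρ) ^ J ≤ ∣ A ∣ₛ
  construction N@(suc n) _ with K₀ ℕP.≤? N
  ... | no K₀≰N = 0 , ⁅ Fin.zero ⁆ , singleton-avoidsF , N≤c₂ , ℕP.≤-reflexive (sym (∣⁅x⁆∣≡1 (Fin.zero {n})))
    where
    singleton-avoidsF : AvoidsF ⁅ Fin.zero ⁆
    singleton-avoidsF i j i∈ j∈ _ _ = trans (x∈⁅y⁆⇒x≡y Fin.zero i∈) (sym (x∈⁅y⁆⇒x≡y Fin.zero j∈))
    N≤c₂ : N ≤ c₂ * 1
    N≤c₂ = ℕP.≤-trans (ℕP.<⇒≤ (ℕP.≰⇒> K₀≰N))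
             (ℕP.≤-trans (ℕP.m≤m*n K₀ b {{ℕP.m^n≢0 m d}}) (ℕP.≤-reflexive (sym (ℕP.*-identityʳ c₂))))
  ... | yes K₀≤N with bracket-by-powers K₀ b K₀>0 b≥2 N K₀≤N
  ...   | J , K₀b^J≤N , N<K₀b^J+1 =
    J , levelSet N J , levelSet-avoidsF N J , ℕP.<⇒≤ (subst (N <_) (sym (ℕP.*-assoc K₀ b (b ^ J))) N<K₀b^J+1) ,
    levelSet-size N J K₀b^J≤N

  size-bound : ∀ {N} (A : Subset N) J → N ≤ c₂ * b ^ J → (m ^ d′ * ρ) ^ J ≤ ∣ A ∣ₛ →
               ∀ p q → m ^ p ≤ ρ ^ q → 1 ^ (d * q) * N ^ (d′ * q + p) ≤ (c₂ * ∣ A ∣ₛ) ^ (d * q)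
  size-bound {N} A J N≤ G≤∣A∣ p q m^p≤ρ^q = begin
    1 ^ (d * q) * N ^ X                  ≡⟨ trans (cong (_* N ^ X) (ℕP.^-zeroˡ (d * q))) (ℕP.*-identityˡ (N ^ X)) ⟩
    N ^ X                                ≤⟨ ℕP.^-monoˡ-≤ X N≤ ⟩
    (c₂ * b ^ J) ^ X                     ≡⟨ [m*n]^o≡m^o*n^o c₂ (b ^ J) X ⟩
    c₂ ^ X * (b ^ J) ^ X                 ≤⟨ ℕP.*-mono-≤ (ℕP.^-monoʳ-≤ c₂ {{ℕ.>-nonZero c₂>0}} X≤dq)
                                                          (power-exchange m ρ d′ p q J m^p≤ρ^q) ⟩
    c₂ ^ (d * q) * ((m ^ d′ * ρ) ^ J) ^ (d * q) ≡⟨ sym ([m*n]^o≡m^o*n^o c₂ _ (d * q)) ⟩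
    (c₂ * (m ^ d′ * ρ) ^ J) ^ (d * q)    ≤⟨ ℕP.^-monoˡ-≤ (d * q) (ℕP.*-monoʳ-≤ c₂ G≤∣A∣) ⟩
    (c₂ * ∣ A ∣ₛ) ^ (d * q)              ∎
    where
    open ℕP.≤-Reasoning
    X = d′ * q + p
    p≤q : p ≤ q
    p≤q = ^-cancelʳ-≤ m m≥2 p q (ℕP.≤-trans m^p≤ρ^q (ℕP.^-monoˡ-≤ q (∣p∣≤n R)))
    X≤dq : X ≤ d * q
    X≤dq = ℕP.≤-trans (ℕP.+-monoʳ-≤ (d′ * q) p≤q) (ℕP.≤-reflexive (ℕP.+-comm (d′ * q) q))

  result : Σ ℕ λ c₁ → Σ ℕ λ c₂ → 0 < c₁ × 0 < c₂ ×
           ((N : ℕ) → 0 < N → Σ (Subset N) λ A → AvoidsF A ×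
              (∀ p q → 0 < q → m ^ p ≤ ρ ^ q → c₁ ^ (d * q) * N ^ ((d ℕ.∸ 1) * q + p) ≤ (c₂ * ∣ A ∣ₛ) ^ (d * q)))
  result = 1 , c₂ , s≤s z≤n , c₂>0 , λ N N>0 → let J , A , avoids , N≤ , G≤∣A∣ = construction N N>0 in
    A , avoids , λ p q _ → size-bound A J N≤ G≤∣A∣ p q

theorem1p6 :
    (m : ℕ) → 2 ≤ m → SquareFree m →
    (d k : ℕ) → k ≤ d → 2 ≤ k →
    (a : ℕ → ℤ) →
    (∀ i → i < k → a i ≡ + 0) →
    a d ≢ + 0 →
    Coprime ℤ.∣ a k ∣ m →
    (∀ x → evalUpTo a d x ≡ + 0 [mod m ] → x ≡ + 0 [mod m ]) →
    (R : Subset m) → 0 < ∣ R ∣ₛ →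
    (∀ r r′ → r ∈ R → r′ ∈ R → r ≢ r′ →
      ∀ (x : ℤ) → ¬ ((+ toℕ r) ℤ.- (+ toℕ r′) ≡ x ℤ.^ k [mod m ])) →
    -- constant c = c₁ / c₂ > 0 (rational; equivalent to a real constant)
    Σ ℕ λ c₁ → Σ ℕ λ c₂ → 0 < c₁ × 0 < c₂ ×
      ((N : ℕ) → 0 < N →
        Σ (Subset N) λ A →
          (∀ i j → i ∈ A → j ∈ A → ∀ (x : ℤ) →
             elem i ℤ.- elem j ≡ evalUpTo a d x → i ≡ j) ×
          -- |A| ≥ c N^γ,  γ = (d - 1 + log_m |R|)/d, encoded exactly:
          -- for all p/q ≤ log_m |R| (i.e. m^p ≤ |R|^q):
          --   (c₂ |A|)^(d q) ≥ c₁^(d q) N^((d-1) q + p)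
          (∀ p q → 0 < q → m ℕ.^ p ≤ ∣ R ∣ₛ ℕ.^ q →
             c₁ ℕ.^ (d ℕ.* q) ℕ.* N ℕ.^ ((d ℕ.∸ 1) ℕ.* q ℕ.+ p)
               ≤ (c₂ ℕ.* ∣ A ∣ₛ) ℕ.^ (d ℕ.* q)))
-- The argument only needs k ≥ 1; 2 ≤ k merely rules out k = 0.
theorem1p6 m m≥2 sf d (suc k′) k≤d _ a low a[d]≢0 cop onlyRoot R R≢∅ R-noKthPower
  with d ℕ.∸ suc k′ | ℕP.m+[n∸m]≡n k≤d
... | e | refl = LowerBound.result m m≥2 sf k′ e a low a[d]≢0 cop onlyRoot R R≢∅ R-noKthPower
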